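{- For every integer $q\ge 2$ there are infinitely many pairs of distinct primes $r<s$ such that, when $r$ and $s$ are written in base $q$ with the same number $n$ of digits (padding with leading zeros if necessary), i.e. $r=\sum_{i=0}^{n-1}r_iq^i$ and $s=\sum_{i=0}^{n-1}s_iq^i$ with $r_i,s_i\in\{0,\dots,q-1\}$, the number of indices $i$ with $r_i\neq s_i$ is at most $2$. -}

module Defs where

open import Data.Nat using (ℕ; zero; suc; _+_; _^_; _≟_; _<_; NonZero)
open import Data.Nat.DivMod using (_/_; _%_)
open import Relation.Nullary using (yes; no)
open import Data.Nat.Properties using (m^n≢0)

digit : (q : ℕ) .{{_ : NonZero q}} → ℕ → ℕ → ℕ
digit q m i = (_/_ m (q ^ i) {{m^n≢0 q i}}) % q

digitDiffCount : (q : ℕ) .{{_ : NonZero q}} → ℕ → ℕ → ℕ → ℕ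
digitDiffCount q zero    r s = 0
digitDiffCount q (suc n) r s with digit q r n ≟ digit q s n
... | yes _ = digitDiffCount q n r s
... | no  _ = suc (digitDiffCount q n r s)

module Submission where

-- Two distinct primes below q^n lying in one-digit neighbourhoods of a common number
-- differ in at most two base-q digits.  The neighbourhood of an n-digit number consists of
-- the number itself and its n·(q-1) one-digit changes, so there are n·(q-1) + 1 of them;
-- if the primes in (B, q^n) are so many that their neighbourhoods overflow the q^n
-- available values, two neighbourhoods meet (pigeonhole) and we get the required pair.
--
-- The counting needs a Chebyshev-type lower bound for the number of primes, which we prove
-- in Erdős's way: Legendre's formula for p-adic valuations of factorials shows that every
-- prime power dividing C(2m, m) is at most 2m, so 4^m ≤ (2m+1)·C(2m, m) ≤ (2m+1)·(2m)^π(2m).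

open import Data.Nat
open import Data.Nat.Properties
open import Data.Nat.DivMod
open import Data.Nat.Divisibility
open import Data.Nat.Primality
open import Data.Nat.Primality.Factorisation using (factorise)
open import Data.Nat.Combinatorics using (_C_; nCk≡n!/k![n-k]!; k![n∸k]!∣n!)
open import Data.Nat.ListAction using (product)
open import Data.Nat.Induction using (<-rec)
open import Data.Nat.Tactic.RingSolver using (solve-∀)
open import Data.Fin as Fin using (Fin; toℕ; fromℕ<; punchIn; remQuot; combine)
import Data.Fin.Properties as Finₚ
open import Data.Vec.Functional using (updateAt)
open import Data.Vec.Functional.Properties using (updateAt-updates; updateAt-minimal)
open import Data.List using (List; []; _∷_; length; lookup; filter; upTo; _++_)
open import Data.List.Properties using (length-filter; length-upTo; length-++)
open import Data.List.Membership.Propositional using (_∈_)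
open import Data.List.Membership.Propositional.Properties
  using (∉[]; ∈-lookup; ∈-filter⁺; ∈-filter⁻; ∈-upTo⁺; ∈-upTo⁻; ∈-++⁺ˡ; ∈-++⁺ʳ)
open import Data.List.Relation.Unary.Any using (here; there)
open import Data.List.Relation.Unary.All as All using (_∷_)
open import Data.List.Relation.Unary.AllPairs using (_∷_)
open import Data.List.Relation.Unary.Unique.Propositional using (Unique)
open import Data.List.Relation.Unary.Unique.Propositional.Properties using (filter⁺; upTo⁺)
open import Data.Product using (Σ; ∃; ∃₂; ∃-syntax; _×_; _,_; proj₁; proj₂; uncurry)
open import Data.Sum using (_⊎_; inj₁; inj₂; [_,_])
open import Function using (_∘_)
open import Relation.Nullary using (Dec; yes; no; contradiction)
open import Relation.Nullary.Decidable using (_×-dec_)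
open import Relation.Binary.Definitions using (tri<; tri≈; tri>)
open import Relation.Binary.PropositionalEquality
  using (_≡_; _≢_; refl; sym; trans; cong; cong₂; subst; module ≡-Reasoning)
open import Defs

n<m^n : ∀ m n → 1 < m → n < m ^ n
n<m^n m zero    _   = s≤s z≤n
n<m^n m@(suc _) (suc n) 1<m = begin-strict
  suc n       ≤⟨ n<m^n m n 1<m ⟩
  m ^ n       <⟨ m<m*n (m ^ n) m 1<m ⟩
  m ^ n * m   ≡⟨ *-comm (m ^ n) m ⟩
  m * m ^ n   ∎
  where
  open ≤-Reasoning
  instance _ = m^n≢0 m n

^-monoʳ-∣ : ∀ m {i j} → i ≤ j → m ^ i ∣ m ^ j
^-monoʳ-∣ m {i} {j} i≤j = divides (m ^ (j ∸ i)) (begin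
  m ^ j                ≡⟨ cong (m ^_) (m∸n+n≡m i≤j) ⟨
  m ^ (j ∸ i + i)      ≡⟨ ^-distribˡ-+-* m (j ∸ i) i ⟩
  m ^ (j ∸ i) * m ^ i  ∎)
  where open ≡-Reasoning

/-unique : ∀ d .{{_ : NonZero d}} r a → r < d → (r + a * d) / d ≡ a
/-unique d r a r<d = begin
  (r + a * d) / d    ≡⟨ +-distrib-/-∣ʳ r (n∣m*n a) ⟩
  r / d + a * d / d  ≡⟨ cong₂ _+_ (m<n⇒m/n≡0 r<d) (m*n/n≡m a d) ⟩
  a                  ∎
  where open ≡-Reasoning

/-suc : ∀ d .{{_ : NonZero d}} n →
  (d ∣ suc n × suc n / d ≡ suc (n / d)) ⊎ (d ∤ suc n × suc n / d ≡ n / d)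
/-suc d n with suc (n % d) <? d
... | yes r<d = inj₂ (d∤1+n , trans (/-congˡ split) (/-unique d _ (n / d) r<d))
  where
  open ≡-Reasoning
  split : suc n ≡ suc (n % d) + n / d * d
  split = cong suc (m≡m%n+[m/n]*n n d)
  d∤1+n : d ∤ suc n
  d∤1+n d∣1+n = 0≢1+n (begin
    0                              ≡⟨ n∣m⇒m%n≡0 (suc n) d d∣1+n ⟨
    suc n % d                      ≡⟨ %-congˡ split ⟩
    (suc (n % d) + n / d * d) % d  ≡⟨ [m+kn]%n≡m%n (suc (n % d)) (n / d) d ⟩
    suc (n % d) % d                ≡⟨ m<n⇒m%n≡m r<d ⟩
    suc (n % d)                    ∎)
... | no r≮d =
  inj₁ (divides (suc (n / d)) split , trans (/-congˡ split) (m*n/n≡m (suc (n / d)) d))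
  where
  open ≡-Reasoning
  r+1≡d : suc (n % d) ≡ d
  r+1≡d = ≤-antisym (m%n<n n d) (≮⇒≥ r≮d)
  split : suc n ≡ suc (n / d) * d
  split = begin
    suc n                    ≡⟨ cong suc (m≡m%n+[m/n]*n n d) ⟩
    suc (n % d) + n / d * d  ≡⟨ cong (_+ n / d * d) r+1≡d ⟩
    d + n / d * d            ∎

double-decomposition : ∀ d .{{_ : NonZero d}} m →
  m + m ≡ (m % d + m % d) + (m / d + m / d) * d
double-decomposition d m =
  trans (cong₂ _+_ (m≡m%n+[m/n]*n m d) (m≡m%n+[m/n]*n m d)) (regroup (m % d) (m / d) d)
  where
  regroup : ∀ r u d → r + u * d + (r + u * d) ≡ (r + r) + (u + u) * d
  regroup = solve-∀

/-double : ∀ d .{{_ : NonZero d}} m →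
  (m + m) / d ≡ m / d + m / d ⊎ ((m + m) / d ≡ suc (m / d + m / d) × d ≤ m + m)
/-double d m with m % d + m % d <? d
... | yes 2r<d =
  inj₁ (trans (/-congˡ (double-decomposition d m)) (/-unique d _ (m / d + m / d) 2r<d))
... | no 2r≮d = inj₂ (2m/d≡ , m/n≢0⇒n≤m (λ eq → 0≢1+n (trans (sym eq) 2m/d≡)))
  where
  u = m / d
  e = (m % d + m % d) ∸ d
  d+e≡2r : d + e ≡ m % d + m % d
  d+e≡2r = m+[n∸m]≡n (≮⇒≥ 2r≮d)
  e<d : e < d
  e<d = +-cancelˡ-< d e d (subst (_< d + d) (sym d+e≡2r) (+-mono-< (m%n<n m d) (m%n<n m d)))
  shift : ∀ d e w → d + e + w * d ≡ e + suc w * d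
  shift = solve-∀
  split : m + m ≡ e + suc (u + u) * d
  split = begin
    m + m                                  ≡⟨ double-decomposition d m ⟩
    (m % d + m % d) + (u + u) * d          ≡⟨ cong (_+ (u + u) * d) d+e≡2r ⟨
    d + e + (u + u) * d                    ≡⟨ shift d e (u + u) ⟩
    e + suc (u + u) * d                    ∎
    where open ≡-Reasoning
  2m/d≡ : (m + m) / d ≡ suc (u + u)
  2m/d≡ = trans (/-congˡ split) (/-unique d e (suc (u + u)) e<d)

-- p-adic valuations and Legendre's formula, for a fixed base p ≥ 2.
module Valuation (p : ℕ) .{{_ : NonTrivial p}} where

  private
    variable
      a b c k m n x y K : ℕ

  private instance
    p≢0 : NonZero p
    p≢0 = nonTrivial⇒nonZero p

  record IsValuation (x a : ℕ) : Set where
    constructor exactly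
    field
      cofactor : ℕ
      split    : x ≡ p ^ a * cofactor
      coprime  : p ∤ cofactor

  valuation : ∀ x → x ≢ 0 → ∃ (IsValuation x)
  valuation = <-rec _ extract
    where
    rearrange : ∀ u z v → u * z * v ≡ v * u * z
    rearrange = solve-∀
    extract : ∀ x → (∀ {y} → y < x → y ≢ 0 → ∃ (IsValuation y)) →
              x ≢ 0 → ∃ (IsValuation x)
    extract x rec x≢0 with p ∣? x
    ... | no p∤x = 0 , exactly x (sym (*-identityˡ x)) p∤x
    ... | yes (divides y refl) = shift (rec (m<m*n y p (nonTrivial⇒n>1 p)) y≢0)
      where
      y≢0 : y ≢ 0
      y≢0 refl = x≢0 refl
      instance _ = ≢-nonZero y≢0
      shift : ∃ (IsValuation y) → ∃ (IsValuation (y * p))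
      shift (a , exactly z refl p∤z) = suc a , exactly z (rearrange (p ^ a) z p) p∤z

  valuation-divides : IsValuation x a → p ^ a ∣ x
  valuation-divides {a = a} (exactly y refl _) = divides y (*-comm (p ^ a) y)

  valuation-maximal : IsValuation x a → p ^ k ∣ x → k ≤ a
  valuation-maximal {a = a} {k} (exactly y refl p∤y) p^k∣x with k ≤? a
  ... | yes k≤a = k≤a
  ... | no k≰a = contradiction (*-cancelˡ-∣ (p ^ a) {{m^n≢0 p a}} p^a*p∣p^a*y) p∤y
    where
    p^a*p∣p^a*y : p ^ a * p ∣ p ^ a * y
    p^a*p∣p^a*y =
      subst (_∣ p ^ a * y) (*-comm p (p ^ a)) (∣-trans (^-monoʳ-∣ p (≰⇒> k≰a)) p^k∣x)

  valuation-unique : IsValuation x a → IsValuation x b → a ≡ b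
  valuation-unique va vb = ≤-antisym (valuation-maximal vb (valuation-divides va))
                                     (valuation-maximal va (valuation-divides vb))

  -- For prime p, valuations add under multiplication: by Euclid's lemma p does not
  -- divide the product of the cofactors.
  valuation-* : Prime p → IsValuation x a → IsValuation y b → IsValuation (x * y) (a + b)
  valuation-* {a = a} {b = b} pp (exactly u refl p∤u) (exactly w refl p∤w) =
    exactly (u * w) split (λ p∣uw → [ p∤u , p∤w ] (euclidsLemma u w pp p∣uw))
    where
    interchange : ∀ a b c d → a * b * (c * d) ≡ a * c * (b * d)
    interchange = solve-∀
    split : p ^ a * u * (p ^ b * w) ≡ p ^ (a + b) * (u * w)
    split = trans (interchange (p ^ a) u (p ^ b) w) (cong (_* (u * w)) (sym (^-distribˡ-+-* p a b)))

  _/p^_ : ℕ → ℕ → ℕ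
  n /p^ i = (n / p ^ i) {{m^n≢0 p i}}

  legendreSum : ℕ → ℕ → ℕ
  legendreSum n zero    = 0
  legendreSum n (suc i) = legendreSum n i + n /p^ suc i

  legendreSum-zero : ∀ K → legendreSum 0 K ≡ 0
  legendreSum-zero zero    = refl
  legendreSum-zero (suc K) =
    cong₂ _+_ (legendreSum-zero K) (0/n≡0 (p ^ suc K) {{m^n≢0 p (suc K)}})

  -- Passing from n to n + 1 adds min(a, K), a being the exponent of p in n + 1:
  -- the term ⌊(n+1)/p^i⌋ grows by one exactly when p^i ∣ n + 1, i.e. when i ≤ a.
  legendreSum-suc : IsValuation (suc n) a → ∀ K →
    legendreSum (suc n) K ≡ legendreSum n K + a ⊓ K
  legendreSum-suc {a = a} va zero = cong (_+_ 0) (sym (⊓-zeroʳ a))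
  legendreSum-suc {n} {a} va (suc i) with /-suc (p ^ suc i) {{m^n≢0 p (suc i)}} n
  ... | inj₁ (p^i+1∣ , step) = begin
      S (suc n) i + suc n /p^ suc i      ≡⟨ cong₂ _+_ (legendreSum-suc va i) step ⟩
      S n i + a ⊓ i + suc (n /p^ suc i)  ≡⟨ cong (λ t → S n i + t + _) a⊓i≡i ⟩
      S n i + i + suc (n /p^ suc i)      ≡⟨ swap-suc (S n i) i _ ⟩
      S n i + n /p^ suc i + suc i        ≡⟨ cong (S n i + _ +_) (m≥n⇒m⊓n≡n i<a) ⟨
      S n i + n /p^ suc i + a ⊓ suc i    ∎
    where
    open ≡-Reasoning
    S = legendreSum
    i<a : suc i ≤ a
    i<a = valuation-maximal va p^i+1∣
    a⊓i≡i : a ⊓ i ≡ i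
    a⊓i≡i = m≥n⇒m⊓n≡n (<⇒≤ i<a)
    swap-suc : ∀ s u v → s + u + suc v ≡ s + v + suc u
    swap-suc = solve-∀
  ... | inj₂ (p^i+1∤ , step) = begin
      S (suc n) i + suc n /p^ suc i  ≡⟨ cong₂ _+_ (legendreSum-suc va i) step ⟩
      S n i + a ⊓ i + n /p^ suc i      ≡⟨ cong (λ t → S n i + t + _) (m≤n⇒m⊓n≡m a≤i) ⟩
      S n i + a + n /p^ suc i          ≡⟨ swap (S n i) a _ ⟩
      S n i + n /p^ suc i + a          ≡⟨ cong (S n i + _ +_) a⊓[1+i]≡a ⟨
      S n i + n /p^ suc i + a ⊓ suc i  ∎
    where
    open ≡-Reasoning
    S = legendreSum
    a≤i : a ≤ i
    a≤i = ≮⇒≥ (λ i<a → p^i+1∤ (∣-trans (^-monoʳ-∣ p i<a) (valuation-divides va)))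
    a⊓[1+i]≡a : a ⊓ suc i ≡ a
    a⊓[1+i]≡a = m≤n⇒m⊓n≡m (m≤n⇒m≤1+n a≤i)
    swap : ∀ s u v → s + u + v ≡ s + v + u
    swap = solve-∀

  legendre : Prime p → n ≤ K → IsValuation (n !) (legendreSum n K)
  legendre {zero} {K} _ _ =
    subst (IsValuation 1) (sym (legendreSum-zero K)) (exactly 1 refl (nonTrivial⇒≢1 ∘ ∣1⇒≡1))
  legendre {suc n} {K} pp n<K =
    subst (IsValuation (suc n !)) exponent (valuation-* pp ve (legendre pp (<⇒≤ n<K)))
    where
    e = proj₁ (valuation (suc n) (λ ()))
    ve = proj₂ (valuation (suc n) (λ ()))
    e≤K : e ≤ K
    e≤K = <⇒≤ (begin-strict
      e        <⟨ n<m^n p e (nonTrivial⇒n>1 p) ⟩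
      p ^ e    ≤⟨ ∣⇒≤ (valuation-divides ve) ⟩
      suc n    ≤⟨ n<K ⟩
      K        ∎)
      where open ≤-Reasoning
    exponent : e + legendreSum n K ≡ legendreSum (suc n) K
    exponent = begin
      e + legendreSum n K        ≡⟨ +-comm e _ ⟩
      legendreSum n K + e        ≡⟨ cong (legendreSum n K +_) (m≤n⇒m⊓n≡m e≤K) ⟨
      legendreSum n K + e ⊓ K    ≡⟨ legendreSum-suc ve K ⟨
      legendreSum (suc n) K      ∎
      where open ≡-Reasoning

  -- ⌊2m/p^i⌋ − 2⌊m/p^i⌋ is 0 or 1, and 1 only when p^i ≤ 2m.  Summing over
  -- 1 ≤ i ≤ K, the Legendre sum of 2m exceeds twice that of m by some t ≤ K with p^t ≤ 2m.
  legendreSum-double : 1 ≤ m → ∀ K → ∃[ t ]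
    legendreSum (m + m) K ≡ t + (legendreSum m K + legendreSum m K) × t ≤ K × p ^ t ≤ m + m
  legendreSum-double 1≤m zero = 0 , refl , z≤n , ≤-trans 1≤m (m≤m+n _ _)
  legendreSum-double {m} 1≤m (suc i)
    with legendreSum-double 1≤m i | /-double (p ^ suc i) {{m^n≢0 p (suc i)}} m
  ... | t , sum , t≤i , p^t≤2m | inj₁ no-carry =
    t , trans (cong₂ _+_ sum no-carry) (regroup t (legendreSum m i) (m /p^ suc i)) ,
    m≤n⇒m≤1+n t≤i , p^t≤2m
    where
    regroup : ∀ t s u → t + (s + s) + (u + u) ≡ t + ((s + u) + (s + u))
    regroup = solve-∀
  ... | t , sum , t≤i , _ | inj₂ (carry , p^i+1≤2m) =
    suc t , trans (cong₂ _+_ sum carry) (regroup t (legendreSum m i) (m /p^ suc i)) , s≤s t≤i ,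
    ≤-trans (^-monoʳ-≤ p (s≤s t≤i)) p^i+1≤2m
    where
    regroup : ∀ t s u → t + (s + s) + suc (u + u) ≡ suc t + ((s + u) + (s + u))
    regroup = solve-∀

  central-prime-power : Prime p → 1 ≤ m → (m + m) ! ≡ c * (m ! * m !) →
    p ^ k ∣ c → p ^ k ≤ m + m
  central-prime-power {m} {c} {k} pp 1≤m factorials p^k∣c =
    ≤-trans (^-monoʳ-≤ p k≤t) p^t≤2m
    where
    c≢0 : c ≢ 0
    c≢0 refl = ≢-nonZero⁻¹ ((m + m) !) {{(m + m) !≢0}} factorials
    e = proj₁ (valuation c c≢0)
    vc = proj₂ (valuation c c≢0)
    Sm = legendreSum m (m + m)
    vm = legendre {m} {m + m} pp (m≤m+n m m)
    v-product : IsValuation ((m + m) !) (e + (Sm + Sm))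
    v-product = subst (λ x → IsValuation x (e + (Sm + Sm))) (sym factorials)
                      (valuation-* pp vc (valuation-* pp vm vm))
    double = legendreSum-double 1≤m (m + m)
    t = proj₁ double
    p^t≤2m = proj₂ (proj₂ (proj₂ double))
    e≡t : e ≡ t
    e≡t = +-cancelʳ-≡ (Sm + Sm) e t (trans (sym (valuation-unique v-legendre v-product))
                                          (proj₁ (proj₂ double)))
      where v-legendre = legendre {m + m} pp ≤-refl
    k≤t : k ≤ t
    k≤t = subst (k ≤_) e≡t (valuation-maximal vc p^k∣c)

no-prime-factor⇒≤1 : ∀ {x} → x ≢ 0 → (∀ {r} → Prime r → r ∤ x) → x ≤ 1
no-prime-factor⇒≤1 {x} x≢0 none with factorise x {{≢-nonZero x≢0}}
... | record { factors = [] ; isFactorisation = x≡1 } = ≤-reflexive x≡1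
... | record { factors = r ∷ rs ; isFactorisation = x≡r*rs ; factorsPrime = r-prime ∷ _ } =
  contradiction (divides (product rs) (trans x≡r*rs (*-comm r (product rs)))) (none r-prime)

-- A nonzero x whose prime factors all lie in L and whose prime-power divisors are all at
-- most M satisfies x ≤ M^|L|: split off the full power of the first listed prime and recurse.
prime-powers-bound : ∀ (L : List ℕ) {M x} → 1 ≤ M → x ≢ 0 →
  (∀ {r} → Prime r → r ∣ x → r ∈ L) →
  (∀ {r} k → Prime r → r ^ k ∣ x → r ^ k ≤ M) →
  x ≤ M ^ length L
prime-powers-bound [] 1≤M x≢0 in-L _ =
  no-prime-factor⇒≤1 x≢0 (λ r-prime r∣x → ∉[] (in-L r-prime r∣x))
prime-powers-bound (r ∷ L) {M} {x} 1≤M x≢0 in-L bounded with prime? r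
... | no ¬r-prime = ≤-trans (prime-powers-bound L 1≤M x≢0 in-L′ bounded) (m≤n*m _ M)
  where
  instance _ = >-nonZero 1≤M
  in-L′ : ∀ {s} → Prime s → s ∣ x → s ∈ L
  in-L′ s-prime s∣x with in-L s-prime s∣x
  ... | here refl = contradiction s-prime ¬r-prime
  ... | there s∈L = s∈L
... | yes r-prime = begin
    x                 ≡⟨ split ⟩
    r ^ e * y         ≤⟨ *-mono-≤ (bounded e r-prime (valuation-divides ve)) y-bound ⟩
    M * M ^ length L  ∎
  where
  open ≤-Reasoning
  open Valuation r {{prime⇒nonTrivial r-prime}}
  e = proj₁ (valuation x x≢0)
  ve = proj₂ (valuation x x≢0)
  open IsValuation ve renaming (cofactor to y)
  y∣x : y ∣ x
  y∣x = divides (r ^ e) split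
  y≢0 : y ≢ 0
  y≢0 y≡0 = x≢0 (trans split (trans (cong (r ^ e *_) y≡0) (*-zeroʳ (r ^ e))))
  in-L′ : ∀ {s} → Prime s → s ∣ y → s ∈ L
  in-L′ s-prime s∣y with in-L s-prime (∣-trans s∣y y∣x)
  ... | here refl = contradiction s∣y coprime
  ... | there s∈L = s∈L
  y-bound : y ≤ M ^ length L
  y-bound = prime-powers-bound L 1≤M y≢0 in-L′
              (λ k s-prime s^k∣y → bounded k s-prime (∣-trans s^k∣y y∣x))

centralBinomial : ℕ → ℕ
centralBinomial m = (m + m) C m

central-factorials : ∀ m → (m + m) ! ≡ centralBinomial m * (m ! * m !)
central-factorials m = begin
  (m + m) !                      ≡⟨ m/n*n≡m {{m !* (m + m ∸ m) !≢0}} (k![n∸k]!∣n! m≤2m) ⟨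
  (m + m) ! / d * d              ≡⟨ cong₂ _*_ (sym (nCk≡n!/k![n-k]! m≤2m)) d≡m!m! ⟩
  centralBinomial m * (m ! * m !) ∎
  where
  open ≡-Reasoning
  m≤2m = m≤m+n m m
  d = m ! * (m + m ∸ m) !
  instance _ = m !* (m + m ∸ m) !≢0
  d≡m!m! : d ≡ m ! * m !
  d≡m!m! = cong (λ j → m ! * j !) (m+n∸m≡n m m)

-- C(2m+2, m+1) · (m+1) = 2(2m+1) · C(2m, m), by comparing (2m+2)! with (2m)!.
central-step : ∀ m → centralBinomial (suc m) * suc m ≡ 2 * suc (m + m) * centralBinomial m
central-step m =
  *-cancelʳ-≡ _ _ (suc m) (*-cancelʳ-≡ _ _ (m ! * m !) {{m !* m !≢0}} (begin
    b′ * suc m * suc m * (m ! * m !)                   ≡⟨ square b′ (suc m) (m !) ⟩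
    b′ * (suc m ! * suc m !)                           ≡⟨ central-factorials (suc m) ⟨
    (suc m + suc m) !                                  ≡⟨ cong (λ j → T * j !) (+-suc m m) ⟩
    T * (suc (m + m) * (m + m) !)                      ≡⟨ cong (λ f → T * (suc (m + m) * f))
                                                               (central-factorials m) ⟩
    T * (suc (m + m) * (b * (m ! * m !)))              ≡⟨ regroup m b (m ! * m !) ⟩
    2 * suc (m + m) * b * suc m * (m ! * m !)          ∎))
  where
  open ≡-Reasoning
  b = centralBinomial m
  b′ = centralBinomial (suc m)
  T = suc (m + suc m)
  square : ∀ c s f → c * s * s * (f * f) ≡ c * (s * f * (s * f))
  square = solve-∀
  regroup : ∀ m c g → suc (m + suc m) * (suc (m + m) * (c * g)) ≡
                      2 * suc (m + m) * c * suc m * g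
  regroup = solve-∀

-- 4^m ≤ (2m+1)·C(2m, m), by induction: central-step multiplies the right-hand side by
-- 2(2m+3)/(m+1) ≥ 4 when passing from m to m + 1.
central-lower : ∀ m → 4 ^ m ≤ suc (m + m) * centralBinomial m
central-lower zero = s≤s z≤n
central-lower (suc m) = *-cancelˡ-≤ (suc m) (begin
  suc m * (4 * 4 ^ m)                          ≡⟨ *-assoc (suc m) 4 (4 ^ m) ⟨
  suc m * 4 * 4 ^ m                            ≤⟨ *-mono-≤ 4[m+1]≤2T (central-lower m) ⟩
  2 * T * (suc (m + m) * centralBinomial m)    ≡⟨ regroup T (suc (m + m)) (centralBinomial m) ⟩
  T * (2 * suc (m + m) * centralBinomial m)    ≡⟨ cong (T *_) (central-step m) ⟨
  T * (centralBinomial (suc m) * suc m)        ≡⟨ rotate T (centralBinomial (suc m)) (suc m) ⟩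
  suc m * (T * centralBinomial (suc m))        ∎)
  where
  open ≤-Reasoning
  T = suc (suc m + suc m)
  4[m+1]≤2T : suc m * 4 ≤ 2 * T
  4[m+1]≤2T = subst (suc m * 4 ≤_) (two-more m) (m≤n+m (suc m * 4) 2)
    where
    two-more : ∀ m → 2 + suc m * 4 ≡ 2 * suc (suc m + suc m)
    two-more = solve-∀
  regroup : ∀ t u c → 2 * t * (u * c) ≡ t * (2 * u * c)
  regroup = solve-∀
  rotate : ∀ t c s → t * (c * s) ≡ s * (t * c)
  rotate = solve-∀

-- Chebyshev's lower bound in Erdős's form: if L contains every prime up to 2m, then
-- 4^m ≤ (2m+1)·(2m)^|L|, because C(2m, m) is a product of prime powers at most 2m.
chebyshev : ∀ m (L : List ℕ) → 1 ≤ m →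
  (∀ {r} → Prime r → r ≤ m + m → r ∈ L) →
  4 ^ m ≤ suc (m + m) * (m + m) ^ length L
chebyshev m L 1≤m in-L = ≤-trans (central-lower m)
  (*-monoʳ-≤ (suc (m + m)) (prime-powers-bound L 1≤2m c≢0 in-L′ bounded))
  where
  1≤2m = ≤-trans 1≤m (m≤m+n m m)
  c≢0 : centralBinomial m ≢ 0
  c≢0 c≡0 = ≢-nonZero⁻¹ ((m + m) !) {{(m + m) !≢0}}
              (trans (central-factorials m) (cong (_* (m ! * m !)) c≡0))
  bounded : ∀ {r} k → Prime r → r ^ k ∣ centralBinomial m → r ^ k ≤ m + m
  bounded k r-prime = Valuation.central-prime-power _ {{prime⇒nonTrivial r-prime}} {k = k}
                        r-prime 1≤m (central-factorials m)
  in-L′ : ∀ {r} → Prime r → r ∣ centralBinomial m → r ∈ L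
  in-L′ {r} r-prime r∣c = in-L r-prime (subst (_≤ m + m) (^-identityʳ r)
    (bounded 1 r-prime (subst (_∣ centralBinomial m) (sym (^-identityʳ r)) r∣c)))

halves : ∀ n → ∃[ m ] (n ≡ m + m ⊎ n ≡ suc (m + m))
halves zero    = 0 , inj₁ refl
halves (suc n) with halves n
... | m , inj₁ refl = m , inj₂ refl
... | m , inj₂ refl = suc m , inj₁ (cong suc (sym (+-suc m m)))

1≤m+m⇒1≤m : ∀ m → 1 ≤ m + m → 1 ≤ m
1≤m+m⇒1≤m (suc m) _ = s≤s z≤n

4^m≡2^[m+m] : ∀ m → 4 ^ m ≡ 2 ^ (m + m)
4^m≡2^[m+m] m = trans (^-*-assoc 2 2 m) (cong (λ k → 2 ^ (m + k)) (+-identityʳ m))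

chebyshev′ : ∀ M (L : List ℕ) → 2 ≤ M → (∀ {r} → Prime r → r ≤ M → r ∈ L) →
  2 ^ (M ∸ 1) ≤ suc M * M ^ length L
chebyshev′ M L 2≤M in-L with halves M
... | m , inj₁ refl = begin
  2 ^ (m + m ∸ 1)                   ≤⟨ ^-monoʳ-≤ 2 (m∸n≤m (m + m) 1) ⟩
  2 ^ (m + m)                       ≡⟨ 4^m≡2^[m+m] m ⟨
  4 ^ m                             ≤⟨ chebyshev m L (1≤m+m⇒1≤m m (<⇒≤ 2≤M)) in-L ⟩
  suc (m + m) * (m + m) ^ length L  ∎
  where open ≤-Reasoning
... | m , inj₂ refl = begin
  2 ^ (m + m)                       ≡⟨ 4^m≡2^[m+m] m ⟨
  4 ^ m                             ≤⟨ chebyshev m L (1≤m+m⇒1≤m m (s≤s⁻¹ 2≤M)) in-L′ ⟩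
  suc (m + m) * (m + m) ^ length L  ≤⟨ *-mono-≤ (n≤1+n (suc (m + m)))
                                                 (^-monoˡ-≤ (length L) (n≤1+n (m + m))) ⟩
  suc (suc (m + m)) * suc (m + m) ^ length L ∎
  where
  open ≤-Reasoning
  in-L′ : ∀ {r} → Prime r → r ≤ m + m → r ∈ L
  in-L′ r-prime r≤2m = in-L r-prime (m≤n⇒m≤1+n r≤2m)

^-cancelʳ-≤ : ∀ m {i j} → 1 < m → m ^ i ≤ m ^ j → i ≤ j
^-cancelʳ-≤ m 1<m m^i≤m^j = ≮⇒≥ (λ j<i → <⇒≱ (^-monoʳ-< m 1<m j<i) m^i≤m^j)

-- (p + 1)^k ≤ 2^(p·k), since p + 1 ≤ 2^p.
[1+p]^k≤2^[p*k] : ∀ p k → suc p ^ k ≤ 2 ^ (p * k)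
[1+p]^k≤2^[p*k] p k =
  ≤-trans (^-monoˡ-≤ k (n<m^n 2 p (s≤s (s≤s z≤n)))) (≤-reflexive (^-*-assoc 2 p k))

prime-above? : ∀ a r → Dec (a < r × Prime r)
prime-above? a r = a <? r ×-dec prime? r

primesIn : ℕ → ℕ → List ℕ
primesIn a b = filter (prime-above? a) (upTo (suc b))

∈-primesIn⁻ : ∀ {a b r} → r ∈ primesIn a b → a < r × Prime r × r ≤ b
∈-primesIn⁻ {a} r∈ with ∈-filter⁻ (prime-above? a) r∈
... | r∈upTo , a<r , r-prime = a<r , r-prime , s≤s⁻¹ (∈-upTo⁻ r∈upTo)

∈-primesIn⁺ : ∀ {a b r} → a < r → Prime r → r ≤ b → r ∈ primesIn a b
∈-primesIn⁺ {a} a<r r-prime r≤b =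
  ∈-filter⁺ (prime-above? a) (∈-upTo⁺ (s≤s r≤b)) (a<r , r-prime)

primesIn-unique : ∀ a b → Unique (primesIn a b)
primesIn-unique a b = filter⁺ (prime-above? a) (upTo⁺ (suc b))

primesIn-length : ∀ a b → length (primesIn a b) ≤ suc b
primesIn-length a b =
  ≤-trans (length-filter (prime-above? a) (upTo (suc b))) (≤-reflexive (length-upTo (suc b)))

-- The counting step: if N ≤ A·t + D but (A+1)·D < N, then t > D and so N < t·(A+1).
count-arith : ∀ {N A t D} → N ≤ A * t + D → suc A * D < N → N < t * suc A
count-arith {N} {A} {t} {D} N≤ small with t ≤? D
... | yes t≤D = contradiction (begin
  N          ≤⟨ N≤ ⟩
  A * t + D  ≤⟨ +-monoˡ-≤ D (*-monoʳ-≤ A t≤D) ⟩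
  A * D + D  ≡⟨ +-comm (A * D) D ⟩
  suc A * D  ∎) (<⇒≱ small)
  where open ≤-Reasoning
... | no t≰D = begin-strict
  N          ≤⟨ N≤ ⟩
  A * t + D  <⟨ +-monoʳ-< (A * t) (≰⇒> t≰D) ⟩
  A * t + t  ≡⟨ regroup A t ⟩
  t * suc A  ∎
  where
  open ≤-Reasoning
  regroup : ∀ A t → A * t + t ≡ t * suc A
  regroup = solve-∀

-- Let N = (p+1)^n, A = n·p and D = A·(B+2) + 2.  Chebyshev's bound for the
-- primes up to N - 1 gives N - 2 ≤ A·(t + 1) with t ≤ B + 1 + #{primes in (B, N)}, hence
-- N ≤ A·#{primes in (B, N)} + D; so if (A+1)·D < N then N < #{primes in (B, N)}·(A+1).
many-primes : ∀ p n B → suc (n * p) * (n * p * (B + 2) + 2) < suc p ^ n →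
  suc p ^ n < length (primesIn B (suc p ^ n ∸ 1)) * suc (n * p)
many-primes p n B small = count-arith {A = n * p} {t = length L} N≤ small
  where
  open ≤-Reasoning
  N = suc p ^ n
  M = N ∸ 1
  A = n * p
  L = primesIn B M
  t = length (primesIn 0 B ++ L)
  3≤N : 3 ≤ N
  3≤N = ≤-trans (s≤s (m≤n+m 2 (A * (B + 2)))) (≤-trans (s≤s (m≤n*m _ (suc A))) small)
  N≡1+M : N ≡ suc M
  N≡1+M = sym (m+[n∸m]≡n {1} (≤-trans (s≤s z≤n) 3≤N))
  covers : ∀ {r} → Prime r → r ≤ M → r ∈ primesIn 0 B ++ L
  covers {r} r-prime r≤M with r ≤? B
  ... | yes r≤B = ∈-++⁺ˡ (∈-primesIn⁺ (>-nonZero⁻¹ r {{prime⇒nonZero r-prime}}) r-prime r≤B)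
  ... | no  r≰B = ∈-++⁺ʳ (primesIn 0 B) (∈-primesIn⁺ (≰⇒> r≰B) r-prime r≤M)
  exponent-bound : N ∸ 2 ≤ A * suc t
  exponent-bound = ^-cancelʳ-≤ 2 (s≤s (s≤s z≤n)) (begin
    2 ^ (N ∸ 2)              ≡⟨ cong (2 ^_) (∸-+-assoc N 1 1) ⟨
    2 ^ (M ∸ 1)              ≤⟨ chebyshev′ M (primesIn 0 B ++ L) (∸-monoˡ-≤ 1 3≤N) covers ⟩
    suc M * M ^ t            ≡⟨ cong (_* M ^ t) N≡1+M ⟨
    N * M ^ t                ≤⟨ *-monoʳ-≤ N (^-monoˡ-≤ t (m∸n≤m N 1)) ⟩
    N ^ suc t                ≡⟨ ^-*-assoc (suc p) n (suc t) ⟩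
    suc p ^ (n * suc t)      ≤⟨ [1+p]^k≤2^[p*k] p (n * suc t) ⟩
    2 ^ (p * (n * suc t))    ≡⟨ cong (2 ^_) (regroup p n (suc t)) ⟩
    2 ^ (A * suc t)          ∎)
    where
    regroup : ∀ p n s → p * (n * s) ≡ n * p * s
    regroup = solve-∀
  t≤ : suc t ≤ length L + (B + 2)
  t≤ = begin
    suc t                                        ≡⟨ cong suc (length-++ (primesIn 0 B)) ⟩
    suc (length (primesIn 0 B) + length L)       ≤⟨ s≤s (+-monoˡ-≤ _ (primesIn-length 0 B)) ⟩
    suc (suc B + length L)                       ≡⟨ shift B (length L) ⟩
    length L + (B + 2)                           ∎
    where
    shift : ∀ B l → suc (suc B + l) ≡ l + (B + 2)
    shift = solve-∀
  N≤ : N ≤ A * length L + (A * (B + 2) + 2)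
  N≤ = begin
    N                                 ≡⟨ m∸n+n≡m {N} {2} (<⇒≤ 3≤N) ⟨
    N ∸ 2 + 2                         ≤⟨ +-monoˡ-≤ 2 exponent-bound ⟩
    A * suc t + 2                     ≤⟨ +-monoˡ-≤ 2 (*-monoʳ-≤ A t≤) ⟩
    A * (length L + (B + 2)) + 2      ≡⟨ cong (_+ 2) (*-distribˡ-+ A (length L) (B + 2)) ⟩
    A * length L + A * (B + 2) + 2    ≡⟨ +-assoc (A * length L) (A * (B + 2)) 2 ⟩
    A * length L + (A * (B + 2) + 2)  ∎

-- (k + 4)² ≤ 2^(k + 4): passing to k + 5 adds 2(k+4) + 1 ≤ (k+4)² on the left and
-- doubles the right-hand side.
square≤exp : ∀ k → (k + 4) * (k + 4) ≤ 2 ^ (k + 4)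
square≤exp zero    = ≤-refl
square≤exp (suc k) = begin
  suc (k + 4) * suc (k + 4)               ≡⟨ expand k ⟩
  (k + 4) * (k + 4) + (2 * (k + 4) + 1)   ≤⟨ +-monoʳ-≤ ((k + 4) * (k + 4)) linear≤square ⟩
  (k + 4) * (k + 4) + (k + 4) * (k + 4)   ≤⟨ +-mono-≤ (square≤exp k) (square≤exp k) ⟩
  2 ^ (k + 4) + 2 ^ (k + 4)               ≡⟨ cong (2 ^ (k + 4) +_) (+-identityʳ (2 ^ (k + 4))) ⟨
  2 * 2 ^ (k + 4)                         ∎
  where
  open ≤-Reasoning
  expand : ∀ k → suc (k + 4) * suc (k + 4) ≡ (k + 4) * (k + 4) + (2 * (k + 4) + 1)
  expand = solve-∀
  excess : ∀ k → (k + 4) * (k + 4) ≡ (2 * (k + 4) + 1) + (k * k + 6 * k + 7)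
  excess = solve-∀
  linear≤square : 2 * (k + 4) + 1 ≤ (k + 4) * (k + 4)
  linear≤square = subst (2 * (k + 4) + 1 ≤_) (sym (excess k)) (m≤m+n _ _)

quadratic<exponential : ∀ c → ∃[ n ] 1 ≤ n × c * (n * n) < 2 ^ n
quadratic<exponential c = j + j , ≤-trans 1≤j (m≤m+n j j) , (begin-strict
  c * ((j + j) * (j + j))  ≡⟨ regroup c j ⟩
  4 * c * (j * j)          ≤⟨ *-monoʳ-≤ (4 * c) (square≤exp (4 * c)) ⟩
  4 * c * 2 ^ j            <⟨ *-monoˡ-< (2 ^ j) {{m^n≢0 2 j}} 4c<2^j ⟩
  2 ^ j * 2 ^ j            ≡⟨ ^-distribˡ-+-* 2 j j ⟨
  2 ^ (j + j)              ∎)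
  where
  open ≤-Reasoning
  j = 4 * c + 4
  1≤j : 1 ≤ j
  1≤j = ≤-trans (s≤s z≤n) (m≤n+m 4 (4 * c))
  4c<2^j : 4 * c < 2 ^ j
  4c<2^j = ≤-<-trans (m≤m+n (4 * c) 4) (n<m^n 2 j (s≤s (s≤s z≤n)))
  regroup : ∀ c j → c * ((j + j) * (j + j)) ≡ 4 * c * (j * j)
  regroup = solve-∀

-- For every base p + 1 ≥ 2 and bound B some length n meets the hypothesis of many-primes:
-- (A+1)·(A·(B+2) + 2) ≤ (B+4)·(p+1)²·n² < 2^n ≤ (p+1)^n, where A = n·p.
choose-length : ∀ p B → 1 ≤ p → ∃[ n ] suc (n * p) * (n * p * (B + 2) + 2) < suc p ^ n
choose-length p B 1≤p with quadratic<exponential ((B + 4) * (suc p * suc p))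
... | n , 1≤n , below = n , (begin-strict
  suc (n * p) * (n * p * (B + 2) + 2)   ≤⟨ *-mono-≤ A+1≤X D≤ ⟩
  X * (X * (B + 4))                     ≡⟨ regroup n (suc p) B ⟩
  (B + 4) * (suc p * suc p) * (n * n)   <⟨ below ⟩
  2 ^ n                                 ≤⟨ ^-monoˡ-≤ n (s≤s 1≤p) ⟩
  suc p ^ n                             ∎)
  where
  open ≤-Reasoning
  X = n * suc p
  1≤X : 1 ≤ X
  1≤X = *-mono-≤ 1≤n (s≤s z≤n)
  A+1≤X : suc (n * p) ≤ X
  A+1≤X = subst (suc (n * p) ≤_) (sym (*-suc n p)) (+-monoˡ-≤ (n * p) 1≤n)
  D≤ : n * p * (B + 2) + 2 ≤ X * (B + 4)
  D≤ = begin
    n * p * (B + 2) + 2      ≤⟨ +-mono-≤ (*-monoˡ-≤ (B + 2) (*-monoʳ-≤ n (n≤1+n p)))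
                                          (*-monoˡ-≤ 2 1≤X) ⟩
    X * (B + 2) + X * 2      ≡⟨ split X B ⟩
    X * (B + 4)              ∎
    where
    split : ∀ X B → X * (B + 2) + X * 2 ≡ X * (B + 4)
    split = solve-∀
  regroup : ∀ n q B → n * q * (n * q * (B + 4)) ≡ (B + 4) * (q * q) * (n * n)
  regroup = solve-∀

remQuot-injective : ∀ {n} k (c c′ : Fin (n * k)) →
  remQuot {n} k c ≡ remQuot k c′ → c ≡ c′
remQuot-injective {n} k c c′ same = trans (sym (Finₚ.combine-remQuot {n} k c))
  (trans (cong (uncurry combine) same) (Finₚ.combine-remQuot {n} k c′))

pigeonhole-× : ∀ {k l N} (f : Fin k × Fin l → ℕ) → (∀ x → f x < N) → N < k * l →
  ∃₂ λ x y → x ≢ y × f x ≡ f y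
pigeonhole-× {k} {l} f f<N N<kl
  with Finₚ.pigeonhole N<kl (λ i → fromℕ< (f<N (remQuot {k} l i)))
... | i , j , i<j , same =
  remQuot l i , remQuot l j , Finₚ.<⇒≢ i<j ∘ remQuot-injective l i j ,
  trans (sym (Finₚ.toℕ-fromℕ< _)) (trans (cong toℕ same) (Finₚ.toℕ-fromℕ< _))

lookup-injective : ∀ {A : Set} {xs : List A} → Unique xs →
  ∀ i j → lookup xs i ≡ lookup xs j → i ≡ j
lookup-injective (_ ∷ _)    Fin.zero    Fin.zero    _    = refl
lookup-injective (x∉xs ∷ _) Fin.zero    (Fin.suc j) same =
  contradiction same (All.lookup x∉xs (∈-lookup j))
lookup-injective (x∉xs ∷ _) (Fin.suc i) Fin.zero    same =
  contradiction (sym same) (All.lookup x∉xs (∈-lookup i))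
lookup-injective (_ ∷ unique) (Fin.suc i) (Fin.suc j) same =
  cong Fin.suc (lookup-injective unique i j same)

ClosePrimes : (q : ℕ) .{{_ : NonZero q}} → ℕ → Set
ClosePrimes q B = Σ ℕ λ r → Σ ℕ λ s → B < s × r < s × Prime r × Prime s ×
  Σ ℕ λ n → r < q ^ n × s < q ^ n × digitDiffCount q n r s ≤ 2

-- Base-(p+1) digit vectors, their one-digit changes, and the Hamming distance.
module Digits (p : ℕ) where

  private
    variable
      n : ℕ

  q : ℕ
  q = suc p

  -- A digit vector of length n, least significant digit first.
  DigitVec : ℕ → Set
  DigitVec n = Fin n → Fin q

  value : DigitVec n → ℕ
  value {zero}  w = 0
  value {suc n} w = toℕ (w Fin.zero) + q * value (w ∘ Fin.suc)

  value<q^n : (w : DigitVec n) → value w < q ^ n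
  value<q^n {zero}  w = s≤s z≤n
  value<q^n {suc n} w = begin-strict
    toℕ (w Fin.zero) + q * rest  <⟨ +-monoˡ-< (q * rest) (Finₚ.toℕ<n (w Fin.zero)) ⟩
    q + q * rest                 ≡⟨ *-suc q rest ⟨
    q * suc rest                 ≤⟨ *-monoʳ-≤ q (value<q^n (w ∘ Fin.suc)) ⟩
    q * q ^ n                    ∎
    where
    open ≤-Reasoning
    rest = value (w ∘ Fin.suc)

  digit-value : (w : DigitVec n) (j : Fin n) → digit q (value w) (toℕ j) ≡ toℕ (w j)
  digit-value {suc n} w Fin.zero = begin
    (value w / 1) % q         ≡⟨ cong (_% q) (n/1≡n (value w)) ⟩
    (w₀ + q * rest) % q       ≡⟨ cong (λ t → (w₀ + t) % q) (*-comm q rest) ⟩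
    (w₀ + rest * q) % q       ≡⟨ [m+kn]%n≡m%n w₀ rest q ⟩
    w₀ % q                    ≡⟨ m<n⇒m%n≡m (Finₚ.toℕ<n (w Fin.zero)) ⟩
    w₀                        ∎
    where
    open ≡-Reasoning
    w₀ = toℕ (w Fin.zero)
    rest = value (w ∘ Fin.suc)
  digit-value {suc n} w (Fin.suc j) = begin
    ((value w / (q * q ^ i)) {{q^[1+i]≢0}}) % q
      ≡⟨ cong (_% q) (m/n/o≡m/[n*o] (value w) q (q ^ i)) ⟨
    (value w / q / q ^ i) % q
      ≡⟨ cong (λ t → ((t / q ^ i) {{q^i≢0}}) % q) shift ⟩
    digit q rest i
      ≡⟨ digit-value (w ∘ Fin.suc) j ⟩
    toℕ (w (Fin.suc j))
      ∎
    where
    open ≡-Reasoning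
    i = toℕ j
    rest = value (w ∘ Fin.suc)
    instance
      q^i≢0 = m^n≢0 q i
      q^[1+i]≢0 = m^n≢0 q (suc i)
    shift : value w / q ≡ rest
    shift = trans (cong (λ t → (toℕ (w Fin.zero) + t) / q) (*-comm q rest))
                  (/-unique q _ rest (Finₚ.toℕ<n (w Fin.zero)))

  value-injective : (w w′ : DigitVec n) → value w ≡ value w′ → ∀ j → w j ≡ w′ j
  value-injective w w′ same j = Finₚ.toℕ-injective (begin
    toℕ (w j)                    ≡⟨ digit-value w j ⟨
    digit q (value w) (toℕ j)    ≡⟨ cong (λ x → digit q x (toℕ j)) same ⟩
    digit q (value w′) (toℕ j)   ≡⟨ digit-value w′ j ⟩
    toℕ (w′ j)                   ∎)
    where open ≡-Reasoning

  digits : ℕ → DigitVec n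
  digits x j = fromℕ< (m%n<n ((x / q ^ toℕ j) {{m^n≢0 q (toℕ j)}}) q)

  toℕ-digits : ∀ x (j : Fin n) → toℕ (digits x j) ≡ digit q x (toℕ j)
  toℕ-digits x j = Finₚ.toℕ-fromℕ< _

  -- Replace digit i by the d-th of the p digits different from it.
  replace : DigitVec n → Fin n × Fin p → DigitVec n
  replace w (i , d) = updateAt w i (λ v → punchIn v d)

  replace-local : ∀ (w : DigitVec n) x j → j ≢ proj₁ x → replace w x j ≡ w j
  replace-local w (i , d) j j≢i = updateAt-minimal j i w j≢i

  replace-moves : ∀ (w : DigitVec n) x → replace w x (proj₁ x) ≢ w (proj₁ x)
  replace-moves w (i , d) moved =
    Finₚ.punchInᵢ≢i (w i) d (trans (sym (updateAt-updates i w)) moved)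

  replace-injective : ∀ (w : DigitVec n) x y →
    (∀ j → replace w x j ≡ replace w y j) → x ≡ y
  replace-injective w (i , d) (i′ , d′) same with i Fin.≟ i′
  ... | yes refl = cong (i ,_) (Finₚ.punchIn-injective (w i) d d′ punched)
    where
    punched : punchIn (w i) d ≡ punchIn (w i) d′
    punched = trans (sym (updateAt-updates i w)) (trans (same i) (updateAt-updates i w))
  ... | no i≢i′ =
    contradiction (trans (same i) (replace-local w (i′ , d′) i i≢i′)) (replace-moves w (i , d))

  -- Codes of the one-digit changes of a length-n vector: code 0 changes nothing,
  -- code 1 + c performs the replacement encoded by c ∈ Fin (n·p).
  Change : ℕ → Set
  Change n = Fin (suc (n * p))

  change : DigitVec n → Change n → DigitVec n
  change w Fin.zero    = w
  change w (Fin.suc c) = replace w (remQuot p c)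

  change-local : ∀ (w : DigitVec n) c →
    ∃[ e ] ∀ j → toℕ j ≢ e → change w c j ≡ w j
  change-local w Fin.zero    = 0 , λ _ _ → refl
  change-local {n} w (Fin.suc c) =
    toℕ (proj₁ (remQuot {n} p c)) ,
    λ j j≢i → replace-local w (remQuot p c) j (j≢i ∘ cong toℕ)

  change-injective : ∀ (w : DigitVec n) c c′ →
    (∀ j → change w c j ≡ change w c′ j) → c ≡ c′
  change-injective w Fin.zero    Fin.zero     _    = refl
  change-injective w Fin.zero    (Fin.suc c′) same =
    contradiction (sym (same _)) (replace-moves w _)
  change-injective w (Fin.suc c) Fin.zero     same =
    contradiction (same _) (replace-moves w _)
  change-injective w (Fin.suc c) (Fin.suc c′) same =
    cong Fin.suc (remQuot-injective p c c′ (replace-injective w _ _ same))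

  hamming : ℕ → ℕ → ℕ → ℕ
  hamming = digitDiffCount q

  hamming-zero : ∀ n r s → (∀ j → j < n → digit q r j ≡ digit q s j) → hamming n r s ≡ 0
  hamming-zero zero    r s agree = refl
  hamming-zero (suc n) r s agree with digit q r n ≟ digit q s n
  ... | yes _    = hamming-zero n r s (λ j j<n → agree j (m≤n⇒m≤1+n j<n))
  ... | no  r≢s = contradiction (agree n ≤-refl) r≢s

  hamming-one : ∀ n r s e → (∀ j → j < n → j ≢ e → digit q r j ≡ digit q s j) →
    hamming n r s ≤ 1
  hamming-one zero    r s e agree = z≤n
  hamming-one (suc n) r s e agree with digit q r n ≟ digit q s n
  ... | yes _ = hamming-one n r s e (λ j j<n → agree j (m≤n⇒m≤1+n j<n))
  ... | no r≢s with n ≟ e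
  ...   | yes refl = s≤s (≤-reflexive (hamming-zero n r s agree-below))
    where
    agree-below : ∀ j → j < n → digit q r j ≡ digit q s j
    agree-below j j<n = agree j (m≤n⇒m≤1+n j<n) (<⇒≢ j<n)
  ...   | no  n≢e  = contradiction (agree n ≤-refl n≢e) r≢s

  -- The triangle inequality: a digit where r and s differ is one where r differs from t or
  -- s differs from t.
  hamming-triangle : ∀ n r s t → hamming n r s ≤ hamming n r t + hamming n s t
  hamming-triangle zero r s t = z≤n
  hamming-triangle (suc n) r s t
    with hamming-triangle n r s t
       | digit q r n ≟ digit q s n | digit q r n ≟ digit q t n | digit q s n ≟ digit q t n
  ... | ih | yes _ | yes _ | yes _ = ih
  ... | ih | yes _ | yes _ | no  _ = ≤-trans ih (+-monoʳ-≤ (hamming n r t) (n≤1+n _))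
  ... | ih | yes _ | no  _ | yes _ = ≤-trans ih (+-monoˡ-≤ (hamming n s t) (n≤1+n _))
  ... | ih | yes _ | no  _ | no  _ = ≤-trans ih (+-mono-≤ (n≤1+n (hamming n r t)) (n≤1+n _))
  ... | ih | no r≢s | yes r≡t | yes s≡t = contradiction (trans r≡t (sym s≡t)) r≢s
  ... | ih | no  _ | yes _ | no  _ =
    subst (suc (hamming n r s) ≤_) (sym (+-suc (hamming n r t) (hamming n s t))) (s≤s ih)
  ... | ih | no  _ | no  _ | yes _ = s≤s ih
  ... | ih | no  _ | no  _ | no  _ = s≤s (≤-trans ih (+-monoʳ-≤ (hamming n r t) (n≤1+n _)))

  change-close : ∀ n r (c : Change n) → hamming n r (value (change (digits {n} r) c)) ≤ 1
  change-close n r c = hamming-one n r x e agree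
    where
    open ≡-Reasoning
    w = digits {n} r
    x = value (change w c)
    e = proj₁ (change-local w c)
    agree : ∀ j → j < n → j ≢ e → digit q r j ≡ digit q x j
    agree j j<n j≢e = begin
      digit q r j              ≡⟨ cong (digit q r) (Finₚ.toℕ-fromℕ< j<n) ⟨
      digit q r (toℕ j′)       ≡⟨ toℕ-digits r j′ ⟨
      toℕ (w j′)               ≡⟨ cong toℕ (proj₂ (change-local w c) j′ j′≢e) ⟨
      toℕ (change w c j′)      ≡⟨ digit-value (change w c) j′ ⟨
      digit q x (toℕ j′)       ≡⟨ cong (digit q x) (Finₚ.toℕ-fromℕ< j<n) ⟩
      digit q x j              ∎
      where
      j′ = fromℕ< j<n
      j′≢e : toℕ j′ ≢ e
      j′≢e = j≢e ∘ trans (sym (Finₚ.toℕ-fromℕ< j<n))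

  Candidate : ℕ → ℕ → ℕ → Set
  Candidate n B r = Prime r × B < r × r < q ^ n

  close-pair : ∀ {n B r s} → r ≢ s → Candidate n B r → Candidate n B s →
    hamming n r s ≤ 2 → hamming n s r ≤ 2 → ClosePrimes q B
  close-pair {n} {B} {r} {s} r≢s (r-prime , B<r , r<N) (s-prime , B<s , s<N) rs≤2 sr≤2
    with <-cmp r s
  ... | tri< r<s _ _ = r , s , B<s , r<s , r-prime , s-prime , n , r<N , s<N , rs≤2
  ... | tri≈ _ r≡s _ = contradiction r≡s r≢s
  ... | tri> _ _ s<r = s , r , B<r , s<r , s-prime , r-prime , n , s<N , r<N , sr≤2

  neighbour : ∀ n (ps : List ℕ) → Fin (length ps) × Change n → ℕ
  neighbour n ps (a , c) = value (change (digits {n} (lookup ps a)) c)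

  neighbour<q^n : ∀ n (ps : List ℕ) x → neighbour n ps x < q ^ n
  neighbour<q^n n ps (a , c) = value<q^n (change (digits {n} (lookup ps a)) c)

  -- Neighbourhood collision: if the one-digit neighbourhoods (n·p + 1 values each) of
  -- distinct candidate primes cannot fit disjointly into [0, q^n), two of them meet, and
  -- the two primes are within Hamming distance 1 + 1 of each other.
  close-primes : ∀ n B (ps : List ℕ) → Unique ps → (∀ {r} → r ∈ ps → Candidate n B r) →
    q ^ n < length ps * suc (n * p) → ClosePrimes q B
  close-primes n B ps unique candidate overflow
    with pigeonhole-× (neighbour n ps) (neighbour<q^n n ps) overflow
  ... | (a , c) , (a′ , c′) , distinct , meet with a Fin.≟ a′
  ...   | yes refl = contradiction (cong (a ,_) same-code) distinct
    where
    w = digits {n} (lookup ps a)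
    same-code : c ≡ c′
    same-code = change-injective w c c′ (value-injective (change w c) (change w c′) meet)
  ...   | no a≢a′ = close-pair {n} (a≢a′ ∘ lookup-injective unique a a′)
                      (candidate (∈-lookup a)) (candidate (∈-lookup a′))
                      (within-two r s r-near s-near) (within-two s r s-near r-near)
    where
    r = lookup ps a
    s = lookup ps a′
    x = neighbour n ps (a , c)
    r-near : hamming n r x ≤ 1
    r-near = change-close n r c
    s-near : hamming n s x ≤ 1
    s-near = subst (λ y → hamming n s y ≤ 1) (sym meet) (change-close n s c′)
    within-two : ∀ u v → hamming n u x ≤ 1 → hamming n v x ≤ 1 → hamming n u v ≤ 2
    within-two u v u-near v-near = ≤-trans (hamming-triangle n u v x) (+-mono-≤ u-near v-near)

open Digits

corollary1 : (q : ℕ) .{{_ : NonZero q}} → 2 ≤ q → (B : ℕ) →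
    Σ ℕ λ r → Σ ℕ λ s → B < s × r < s × Prime r × Prime s ×
    Σ ℕ λ n → r < q ^ n × s < q ^ n × digitDiffCount q n r s ≤ 2
corollary1 (suc p) (s≤s 1≤p) B =
  close-primes p n B primes (primesIn-unique B (N ∸ 1)) candidate (many-primes p n B small)
  where
  n = proj₁ (choose-length p B 1≤p)
  small = proj₂ (choose-length p B 1≤p)
  N = suc p ^ n
  primes = primesIn B (N ∸ 1)
  N-1<N : N ∸ 1 < N
  N-1<N = ∸-monoʳ-< {N} {1} {0} (s≤s z≤n) (m^n>0 (suc p) n)
  candidate : ∀ {r} → r ∈ primes → Candidate p n B r
  candidate r∈ with ∈-primesIn⁻ r∈
  ... | B<r , r-prime , r≤N-1 = r-prime , B<r , ≤-<-trans r≤N-1 N-1<N
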